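{- Let $P=\langle L,\ell^o,\ell^e,V,\tau_P\rangle$ be a program and run the algorithm SPACER (described in the context) on $P$. If SPACER returns SAFE then $P$ is safe, and if SPACER returns UNSAFE then $P$ is unsafe.
   Context: A program is a tuple $P=\langle L,\ell^o,\ell^e,V,\tau\rangle$: $L$ a finite set of control locations, $\ell^o,\ell^e\in L$ the initial and error locations, $V$ a set of Boolean or rational variables, and $\tau:L\times L\to \mathrm{BExpr}(V\cup V')$ mapping pairs of locations to quantifier-free formulas of propositional linear rational arithmetic over current variables $V$ and primed next-state copies $V'$; it is assumed that $\tau(\ell,\ell^o)=\bot$ and $\tau(\ell^e,\ell)=\bot$ for all $\ell$. For a formula $X$, $X'$ is $X$ with all variables primed. A control path is a sequence $\ell^o=\ell_0,\ell_1,\dots,\ell_k$ with $\tau(\ell_i,\ell_{i+1})\neq\bot$; it is feasible if there are states (valuations of $V$) $s_0,\dots,s_k$ with $\tau(\ell_i,\ell_{i+1})[V\leftarrow s_i,V'\leftarrow s_{i+1}]=\top$ for all $i<k$. A counterexample is a pair $\langle\bar\ell,\bar s\rangle$ of a feasible control path ending in $\ell^e$ and a witnessing state sequence; $P$ is safe iff $\ell^e$ lies at the end of no feasible control path. A safety proof is $\pi:L\to 2^{\mathrm{BExpr}(V)}$ with $\bigwedge\pi(\ell^e)\Rightarrow\bot$, $\top\Rightarrow\bigwedge\pi(\ell^o)$ and $(\bigwedge\pi(\ell_i)\wedge\tau(\ell_i,\ell_j))\Rightarrow\bigwedge\pi(\ell_j)'$ for all $\ell_i,\ell_j$. For programs $P_1,P_2$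 and a surjection $\sigma:L_1\to L_2$, $P_1\preceq_\sigma P_2$ iff $V_1=V_2$, $\sigma(\ell^o_1)=\ell^o_2$, $\sigma(\ell^e_1)=\ell^e_2$ and $\tau_1(\ell_i,\ell_j)\Rightarrow\tau_2(\sigma(\ell_i),\sigma(\ell_j))$ for all $\ell_i,\ell_j\in L_1$; $P_1\prec_\sigma P_2$ iff $P_1\preceq_\sigma P_2$ and there is no surjection $\nu$ with $P_2\preceq_\nu P_1$. For a transition relation $\tau$ on $L_2$, $\sigma(\tau)(\ell_1,\ell_2)=\tau(\sigma(\ell_1),\sigma(\ell_2))$; $\sigma(\langle\bar\ell,\bar s\rangle)=\langle\sigma(\bar\ell),\bar s\rangle$. $\mathrm{Adapt}(U,\tau,\sigma)$ is $U$ with $\tau_U$ replaced by $\tau_U\wedge\sigma(\tau)$. Algorithm SPACER on input $P$: it maintains $\mathcal{I}:L_P\to 2^{\mathrm{BExpr}(V_P)}$ (initially $\mathcal{I}(\ell)=\emptyset$ for all $\ell$), an abstraction $A$ (initially $A=P$; always $A$ differs from $P$ only in its transition relation) and an under-approximation $U$ with a surjection $\sigma:L_U\to L_P$ such that $U\preceq_\sigma A$ (initially arbitrary such $U,\sigma$). For $U\preceq_\sigma A$, $U_{\mathcal{I}}$ denotes $U$ with $\tau_U$ strengthened to $\lambda\ell_1,\ell_2.\ \bigwedge\mathcal{I}(\sigma(\ell_1))\wedge\tau_U(\ell_1,\ell_2)\wedge\bigwedge\mathcal{I}(\sigma(\ell_2))'$ (and $A_{\mathcal{I}}$ similarly with $\sigma=\mathrm{id}$).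 Each iteration calls an oracle Solve on $U_{\mathcal{I}}$, which returns either a safety proof $\pi$ of $U_{\mathcal{I}}$ or a counterexample $\mathscr{C}$ of $U_{\mathcal{I}}$. (Safe case.) ExtractInvs: for each $\ell\in L_P$ let $\mathcal{R}(\ell)$ be the set of conjuncts of $\bigvee\{\bigwedge\pi(u): u\in L_U,\sigma(u)=\ell\}$; then, while there exist $\ell_i,\ell_j\in L_P$ and $\varphi\in\mathcal{R}(\ell_j)$ such that $\bigwedge\mathcal{R}(\ell_i)\wedge\bigwedge\mathcal{I}(\ell_i)\wedge\tau_P(\ell_i,\ell_j)\not\Rightarrow\varphi'$, remove $\varphi$ from $\mathcal{R}(\ell_j)$; then set $\mathcal{I}(\ell):=\mathcal{I}(\ell)\cup\mathcal{R}(\ell)$ for all $\ell$. If $\bigwedge\mathcal{I}(\ell^e)\Rightarrow\bot$, return SAFE. Otherwise Abstract: writing $\tau_U=\sigma(\tau_A)\wedge\rho$, choose $\hat\tau_P$ with $\tau_P\Rightarrow\hat\tau_P$ and $\hat\rho$ with $\rho\Rightarrow\hat\rho$ such that, for $\hat U$ equal to $U$ but with $\tau_{\hat U}=\sigma(\hat\tau_P)\wedge\hat\rho$, $\pi$ is a safety proof of $\hat U_{\mathcal{I}}$; set $A:=A$ with $\tau_A$ replaced by $\hat\tau_P$ and $U:=\hat U$. Then NextU: choose $\hat U$, $\sigma_1,\sigma_2$ with $U\prec_{\sigma_1}\hat U\preceq_{\sigma_2}A$, $\sigma=\sigma_2\circ\sigma_1$ and $\mathrm{Adapt}(U,\tau_P,\sigma)\prec\mathrm{Adapt}(\hat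 U,\tau_P,\sigma_2)$; set $U:=\hat U$, $\sigma:=\sigma_2$. (Unsafe case.) Refine: if $\sigma(\mathscr{C})$ is a counterexample of $P$, return UNSAFE; otherwise choose $A_{new}$ with $A_{new}\prec_{\mathrm{id}}A$ such that $\sigma(\mathscr{C})$ is not a counterexample of $(A_{new})_{\mathcal{I}}$, and set $A:=A_{new}$, $U:=\mathrm{Adapt}(U,\tau_{A_{new}},\sigma)$. -}

module Defs where

open import Data.Nat using (ℕ; suc)
open import Data.Fin using (Fin; zero; suc; fromℕ; inject₁)
open import Data.Fin.Properties using () renaming (_≟_ to _≟ᶠ_)
open import Data.Rational as Q using (ℚ)
open import Data.Bool using (Bool; true; false; not; _∧_; _∨_)
open import Data.Sum using (_⊎_; inj₁; inj₂; [_,_])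
open import Data.Product using (Σ; ∃; _×_; _,_; proj₁; proj₂)
open import Data.List using (List; []; _∷_; _++_; map; filter; allFin)
open import Data.List.Relation.Unary.All using (All)
import Data.List.Membership.Propositional
open import Relation.Nullary using (¬_)
open import Relation.Nullary.Decidable using (⌊_⌋)
open import Relation.Binary.PropositionalEquality using (_≡_; _≢_)
open import Relation.Binary.Construct.Closure.ReflexiveTransitive using (Star)
open import Function using (id; _∘_)

data LTerm (R : Set) : Set where
  cst  : ℚ → LTerm R
  var  : R → LTerm R
  _⊕_  : LTerm R → LTerm R → LTerm R
  _⊛_  : ℚ → LTerm R → LTerm R

data BExpr (B R : Set) : Set where
  ⊤ₑ ⊥ₑ      : BExpr B R
  bvar       : B → BExpr B R
  _≤ₑ_ _<ₑ_ _≐_ : LTerm R → LTerm R → BExpr B R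
  ¬ₑ_        : BExpr B R → BExpr B R
  _∧ₑ_ _∨ₑ_  : BExpr B R → BExpr B R → BExpr B R

evalT : ∀ {R : Set} → LTerm R → (R → ℚ) → ℚ
evalT (cst q) ρ = q
evalT (var x) ρ = ρ x
evalT (t ⊕ u) ρ = evalT t ρ Q.+ evalT u ρ
evalT (q ⊛ t) ρ = q Q.* evalT t ρ

eval : ∀ {B R : Set} → BExpr B R → (B → Bool) → (R → ℚ) → Bool
eval ⊤ₑ β ρ = true
eval ⊥ₑ β ρ = false
eval (bvar b) β ρ = β b
eval (t ≤ₑ u) β ρ = ⌊ evalT t ρ Q.≤? evalT u ρ ⌋
eval (t <ₑ u) β ρ = ⌊ evalT t ρ Q.<? evalT u ρ ⌋
eval (t ≐ u) β ρ = ⌊ evalT t ρ Q.≟ evalT u ρ ⌋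
eval (¬ₑ f) β ρ = not (eval f β ρ)
eval (f ∧ₑ g) β ρ = eval f β ρ ∧ eval g β ρ
eval (f ∨ₑ g) β ρ = eval f β ρ ∨ eval g β ρ

renT : ∀ {R R' : Set} → (R → R') → LTerm R → LTerm R'
renT g (cst q) = cst q
renT g (var x) = var (g x)
renT g (t ⊕ u) = renT g t ⊕ renT g u
renT g (q ⊛ t) = q ⊛ renT g t

ren : ∀ {B B' R R' : Set} → (B → B') → (R → R') → BExpr B R → BExpr B' R'
ren f g ⊤ₑ = ⊤ₑ
ren f g ⊥ₑ = ⊥ₑ
ren f g (bvar b) = bvar (f b)
ren f g (t ≤ₑ u) = renT g t ≤ₑ renT g u
ren f g (t <ₑ u) = renT g t <ₑ renT g u
ren f g (t ≐ u) = renT g t ≐ renT g u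
ren f g (¬ₑ e) = ¬ₑ ren f g e
ren f g (e ∧ₑ e') = ren f g e ∧ₑ ren f g e'
ren f g (e ∨ₑ e') = ren f g e ∨ₑ ren f g e'

-- Variables V = nb Boolean variables and nr rational variables.

State : ℕ → ℕ → Set
State nb nr = (Fin nb → Bool) × (Fin nr → ℚ)

Form : ℕ → ℕ → Set
Form nb nr = BExpr (Fin nb) (Fin nr)

-- formulas over V ∪ V'  (inj₁ = current copy, inj₂ = primed copy)
TForm : ℕ → ℕ → Set
TForm nb nr = BExpr (Fin nb ⊎ Fin nb) (Fin nr ⊎ Fin nr)

module _ {nb nr : ℕ} where

  cur : Form nb nr → TForm nb nr
  cur = ren inj₁ inj₁

  prime : Form nb nr → TForm nb nr
  prime = ren inj₂ inj₂

  Sat : Form nb nr → State nb nr → Set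
  Sat φ s = eval φ (proj₁ s) (proj₂ s) ≡ true

  SatT : TForm nb nr → State nb nr → State nb nr → Set
  SatT f s s' = eval f [ proj₁ s , proj₁ s' ] [ proj₂ s , proj₂ s' ] ≡ true

  SatAll : List (Form nb nr) → State nb nr → Set
  SatAll Γ s = All (λ φ → Sat φ s) Γ

  IsBotT : TForm nb nr → Set
  IsBotT f = ∀ s s' → ¬ SatT f s s'

  _⇛_ : TForm nb nr → TForm nb nr → Set
  f ⇛ g = ∀ s s' → SatT f s s' → SatT g s s'

  bigAnd : List (Form nb nr) → Form nb nr
  bigAnd [] = ⊤ₑ
  bigAnd (φ ∷ []) = φ
  bigAnd (φ ∷ ψ ∷ Γ) = φ ∧ₑ bigAnd (ψ ∷ Γ)

  bigOr : List (Form nb nr) → Form nb nr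
  bigOr [] = ⊥ₑ
  bigOr (φ ∷ []) = φ
  bigOr (φ ∷ ψ ∷ Γ) = φ ∨ₑ bigOr (ψ ∷ Γ)

  conjuncts : Form nb nr → List (Form nb nr)
  conjuncts (φ ∧ₑ ψ) = conjuncts φ ++ conjuncts ψ
  conjuncts φ = φ ∷ []

-- Programs  ⟨L, ℓᵒ, ℓᵉ, V, τ⟩ with L = Fin nL and V fixed by nb nr.

record Prog (nb nr : ℕ) : Set where
  constructor prog
  field
    nL   : ℕ
    init : Fin nL
    err  : Fin nL
    τ    : Fin nL → Fin nL → TForm nb nr
open Prog public

module _ {nb nr : ℕ} where

  record WF (P : Prog nb nr) : Set where
    field
      noIntoInit : ∀ ℓ → IsBotT (τ P ℓ (init P))
      noOutOfErr : ∀ ℓ → IsBotT (τ P (err P) ℓ)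

  withτ : (P : Prog nb nr) → (Fin (nL P) → Fin (nL P) → TForm nb nr) → Prog nb nr
  withτ P t = prog (nL P) (init P) (err P) t

  record Cex (n : ℕ) : Set where
    constructor cex
    field
      k    : ℕ
      locs : Fin (suc k) → Fin n
      sts  : Fin (suc k) → State nb nr
  open Cex public

  record IsControlPath (P : Prog nb nr) (c : Cex (nL P)) : Set where
    field
      starts : locs c zero ≡ init P
      nonBot : ∀ (i : Fin (k c)) →
               ¬ IsBotT (τ P (locs c (inject₁ i)) (locs c (suc i)))

  record IsCex (P : Prog nb nr) (c : Cex (nL P)) : Set where
    field
      path     : IsControlPath P c
      ends     : locs c (fromℕ (k c)) ≡ err P
      feasible : ∀ (i : Fin (k c)) →
                 SatT (τ P (locs c (inject₁ i)) (locs c (suc i)))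
                      (sts c (inject₁ i)) (sts c (suc i))

  mapCex : ∀ {n m} → (Fin n → Fin m) → Cex n → Cex m
  mapCex σ (cex k ls ss) = cex k (σ ∘ ls) ss

  Safe : Prog nb nr → Set
  Safe P = ¬ Σ (Cex (nL P)) (IsCex P)

  record SafetyProof (P : Prog nb nr) (π : Fin (nL P) → List (Form nb nr)) : Set where
    field
      errBot  : ∀ s → ¬ SatAll (π (err P)) s
      initTop : ∀ s → SatAll (π (init P)) s
      ind     : ∀ i j s s' → SatAll (π i) s → SatT (τ P i j) s s' → SatAll (π j) s'

  Surjective : ∀ {n m} → (Fin n → Fin m) → Set
  Surjective {n} σ = ∀ y → Σ (Fin n) λ x → σ x ≡ y

  -- P₁ ⪯_σ P₂  (V₁ = V₂ holds since both share nb nr)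
  record Refines (P₁ P₂ : Prog nb nr) (σ : Fin (nL P₁) → Fin (nL P₂)) : Set where
    field
      surj  : Surjective σ
      initσ : σ (init P₁) ≡ init P₂
      errσ  : σ (err P₁) ≡ err P₂
      transσ : ∀ i j → τ P₁ i j ⇛ τ P₂ (σ i) (σ j)

  syntax Refines P₁ P₂ σ = P₁ ⪯[ σ ] P₂

  StrictRefines : (P₁ P₂ : Prog nb nr) → (Fin (nL P₁) → Fin (nL P₂)) → Set
  StrictRefines P₁ P₂ σ = (P₁ ⪯[ σ ] P₂) × ¬ Σ (Fin (nL P₂) → Fin (nL P₁)) (λ ν → P₂ ⪯[ ν ] P₁)
  syntax StrictRefines P₁ P₂ σ = P₁ ≺[ σ ] P₂

  _≺_ : Prog nb nr → Prog nb nr → Set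
  P₁ ≺ P₂ = Σ (Fin (nL P₁) → Fin (nL P₂)) λ σ → P₁ ≺[ σ ] P₂

  liftτ : ∀ {n m} → (Fin n → Fin m) → (Fin m → Fin m → TForm nb nr) → Fin n → Fin n → TForm nb nr
  liftτ σ t i j = t (σ i) (σ j)

  adapt : (U : Prog nb nr) → ∀ {m} → (Fin m → Fin m → TForm nb nr) → (Fin (nL U) → Fin m) → Prog nb nr
  adapt U t σ = withτ U (λ i j → τ U i j ∧ₑ liftτ σ t i j)

  -- U_I  (A_I is the case σ = id)
  strengthen : (U : Prog nb nr) → ∀ {m} → (Fin m → List (Form nb nr)) → (Fin (nL U) → Fin m) → Prog nb nr
  strengthen U I σ = withτ U (λ i j → (cur (bigAnd (I (σ i))) ∧ₑ τ U i j) ∧ₑ prime (bigAnd (I (σ j))))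

module _ {nb nr : ℕ} (P : Prog nb nr) where

  Inv : Set
  Inv = Fin (nL P) → List (Form nb nr)

  TRel : Set
  TRel = Fin (nL P) → Fin (nL P) → TForm nb nr

  -- algorithm state: invariants I, abstraction A (given by its transition
  -- relation; A differs from P only there), under-approximation U and σ
  record AState : Set where
    constructor astate
    field
      I  : Inv
      τA : TRel
      U  : Prog nb nr
      σ  : Fin (nL U) → Fin (nL P)
  open AState public

  A-of : AState → Prog nb nr
  A-of S = withτ P (τA S)

  Uᵢ : AState → Prog nb nr
  Uᵢ S = strengthen (U S) (I S) (σ S)

  R₀ : (U : Prog nb nr) → (Fin (nL U) → Fin (nL P)) → (Fin (nL U) → List (Form nb nr)) → Inv
  R₀ U σ π ℓ = conjuncts (bigOr (map (λ u → bigAnd (π u)) (filter (λ u → σ u ≟ᶠ ℓ) (allFin (nL U)))))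

  Entails : Inv → Inv → Fin (nL P) → Fin (nL P) → Form nb nr → Set
  Entails I R ℓi ℓj φ = ∀ s s' → SatAll (R ℓi) s → SatAll (I ℓi) s → SatT (τ P ℓi ℓj) s s' → Sat φ s'

  -- one iteration of the while loop: remove a violating φ from R(ℓⱼ)
  record RemoveStep (I : Inv) (R R' : Inv) : Set where
    field
      ℓi ℓj : Fin (nL P)
      φ     : Form nb nr
      xs ys : List (Form nb nr)
      split : R ℓj ≡ xs ++ φ ∷ ys
      viol  : ¬ Entails I R ℓi ℓj φ
      newj  : R' ℓj ≡ xs ++ ys
      others : ∀ ℓ → ℓ ≢ ℓj → R' ℓ ≡ R ℓ

  record ExtractInvs (I : Inv) (U : Prog nb nr) (σ : Fin (nL U) → Fin (nL P))
                     (π : Fin (nL U) → List (Form nb nr)) (I' : Inv) : Set where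
    field
      Rf     : Inv
      loop   : Star (RemoveStep I) (R₀ U σ π) Rf
      stable : ∀ ℓi ℓj φ → φ Data.List.Membership.Propositional.∈ Rf ℓj → Entails I Rf ℓi ℓj φ
      union  : ∀ ℓ → I' ℓ ≡ I ℓ ++ Rf ℓ

  data Outcome : Set where
    SAFE UNSAFE : Outcome

  record Initial (S : AState) : Set where
    field
      noInvs : ∀ ℓ → I S ℓ ≡ []
      AisP   : ∀ ℓ ℓ' → τA S ℓ ℓ' ≡ τ P ℓ ℓ'
      Uwf    : WF (U S)
      U⪯A    : U S ⪯[ σ S ] A-of S

  data Returns (S : AState) : Outcome → Set where
    retSAFE : (π : Fin (nL (U S)) → List (Form nb nr)) → SafetyProof (Uᵢ S) π →
              (I' : Inv) → ExtractInvs (I S) (U S) (σ S) π I' →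
              (∀ s → ¬ SatAll (I' (err P)) s) →
              Returns S SAFE
    retUNSAFE : (c : Cex (nL (U S))) → IsCex (Uᵢ S) c →
                IsCex P (mapCex (σ S) c) →
                Returns S UNSAFE

  data Step (S : AState) : AState → Set where
    stepSafe :
      (π : Fin (nL (U S)) → List (Form nb nr)) → SafetyProof (Uᵢ S) π →
      (I' : Inv) → ExtractInvs (I S) (U S) (σ S) π I' →
      ¬ (∀ s → ¬ SatAll (I' (err P)) s) →
      -- Abstract: τ_U = σ(τ_A) ∧ ρ
      (ρ : Fin (nL (U S)) → Fin (nL (U S)) → TForm nb nr) →
      (∀ i j → τ (U S) i j ⇛ (liftτ (σ S) (τA S) i j ∧ₑ ρ i j)) →
      (∀ i j → (liftτ (σ S) (τA S) i j ∧ₑ ρ i j) ⇛ τ (U S) i j) →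
      (τ̂ : TRel) → (∀ i j → τ P i j ⇛ τ̂ i j) → WF (withτ P τ̂) →
      (ρ̂ : Fin (nL (U S)) → Fin (nL (U S)) → TForm nb nr) → (∀ i j → ρ i j ⇛ ρ̂ i j) →
      let U₁ = withτ (U S) (λ i j → liftτ (σ S) τ̂ i j ∧ₑ ρ̂ i j) in
      WF U₁ →
      SafetyProof (strengthen U₁ I' (σ S)) π →
      -- NextU
      (Û : Prog nb nr) → WF Û →
      (σ₁ : Fin (nL U₁) → Fin (nL Û)) → (σ₂ : Fin (nL Û) → Fin (nL P)) →
      U₁ ≺[ σ₁ ] Û → Û ⪯[ σ₂ ] withτ P τ̂ →
      (∀ u → σ S u ≡ σ₂ (σ₁ u)) →
      adapt U₁ (τ P) (σ S) ≺ adapt Û (τ P) σ₂ →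
      Step S (astate I' τ̂ Û σ₂)
    stepRefine :
      (c : Cex (nL (U S))) → IsCex (Uᵢ S) c →
      ¬ IsCex P (mapCex (σ S) c) →
      (τnew : TRel) → WF (withτ P τnew) →
      withτ P τnew ≺[ id ] A-of S →
      ¬ IsCex (strengthen (withτ P τnew) (I S) id) (mapCex (σ S) c) →
      Step S (astate (I S) τnew (adapt (U S) τnew (σ S)) (σ S))

  data Reachable : AState → Set where
    start : ∀ {S} → Initial S → Reachable S
    next  : ∀ {S S'} → Reachable S → Step S S' → Reachable S'

module Submission where

open import Defs
open import Data.Nat using (ℕ; suc)
open import Data.Bool using (Bool; true; false; _∧_; _∨_)
open import Data.Fin using (Fin; zero; suc; fromℕ; inject₁)
open import Data.Fin.Properties using () renaming (_≟_ to _≟ᶠ_)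
open import Data.Product using (_×_; _,_)
open import Data.Sum using (inj₁; inj₂)
open import Data.List using (List; []; _∷_; _++_; map; filter; allFin)
open import Data.List.Relation.Unary.All as All using ([]; _∷_)
open import Data.List.Relation.Unary.All.Properties using (++⁺; anti-mono)
open import Data.List.Relation.Unary.Any using (Any; here; there)
open import Data.List.Relation.Unary.Any.Properties using (map⁺)
open import Data.List.Relation.Binary.Subset.Propositional using (_⊆_)
open import Data.List.Membership.Propositional using (_∈_)
open import Data.List.Membership.Propositional.Properties
  using (∈-++⁺ˡ; ∈-++⁺ʳ; ∈-++⁻; ∈-filter⁺; ∈-allFin)
open import Relation.Nullary using (¬_; yes; no)
open import Relation.Binary.PropositionalEquality using (_≡_; refl; subst; sym)
open import Relation.Binary.Construct.Closure.ReflexiveTransitive using (Star; ε; _◅_)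

-- Both verdicts are sound because SPACER only ever records invariants of P.
-- Initially there are none.  ExtractInvs keeps, of the conjuncts R(ℓ) of the
-- under-approximation's proof, only those that are inductive relative to I
-- along the transitions of P itself; R(ℓᵒ) is valid because the proof holds
-- at the initial location of U, which σ maps to ℓᵒ.  Induction over the
-- reachable states of P then shows I ∪ R is again an invariant, so an error
-- location with an unsatisfiable invariant is unreachable.  UNSAFE is only
-- returned together with a counterexample of P.

∧-true : ∀ {a b : Bool} → a ≡ true → b ≡ true → a ∧ b ≡ true
∧-true refl refl = refl

∧-true⁻ : ∀ (a b : Bool) → a ∧ b ≡ true → (a ≡ true) × (b ≡ true)
∧-true⁻ true true refl = refl , refl

∨-trueˡ : ∀ {a} (b : Bool) → a ≡ true → a ∨ b ≡ true
∨-trueˡ b refl = refl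

∨-trueʳ : ∀ (a : Bool) {b} → b ≡ true → a ∨ b ≡ true
∨-trueʳ true  refl = refl
∨-trueʳ false refl = refl

module _ {nb nr : ℕ} where

  Sat-bigAnd : ∀ (Γ : List (Form nb nr)) s → SatAll Γ s → Sat (bigAnd Γ) s
  Sat-bigAnd []          s _        = refl
  Sat-bigAnd (φ ∷ [])    s (p ∷ []) = p
  Sat-bigAnd (φ ∷ ψ ∷ Γ) s (p ∷ ps) = ∧-true p (Sat-bigAnd (ψ ∷ Γ) s ps)

  Sat-bigOr : ∀ (Γ : List (Form nb nr)) s → Any (λ φ → Sat φ s) Γ → Sat (bigOr Γ) s
  Sat-bigOr (φ ∷ [])    s (here p)  = p
  Sat-bigOr (φ ∷ ψ ∷ Γ) s (here p)  = ∨-trueˡ _ p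
  Sat-bigOr (φ ∷ ψ ∷ Γ) s (there p) = ∨-trueʳ _ (Sat-bigOr (ψ ∷ Γ) s p)

  SatAll-conjuncts : ∀ (φ : Form nb nr) s → Sat φ s → SatAll (conjuncts φ) s
  SatAll-conjuncts (φ ∧ₑ ψ) s p with ∧-true⁻ _ _ p
  ... | pφ , pψ = ++⁺ (SatAll-conjuncts φ s pφ) (SatAll-conjuncts ψ s pψ)
  SatAll-conjuncts ⊤ₑ       s p = p ∷ []
  SatAll-conjuncts ⊥ₑ       s p = p ∷ []
  SatAll-conjuncts (bvar x) s p = p ∷ []
  SatAll-conjuncts (x ≤ₑ y) s p = p ∷ []
  SatAll-conjuncts (x <ₑ y) s p = p ∷ []
  SatAll-conjuncts (x ≐ y)  s p = p ∷ []
  SatAll-conjuncts (¬ₑ φ)   s p = p ∷ []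
  SatAll-conjuncts (φ ∨ₑ ψ) s p = p ∷ []

module _ {nb nr : ℕ} (P : Prog nb nr) where

  data Reach : Fin (nL P) → State nb nr → Set where
    reach-init : ∀ s → Reach (init P) s
    reach-step : ∀ {i j s s'} → Reach i s → SatT (τ P i j) s s' → Reach j s'

  IsInvariant : Inv P → Set
  IsInvariant I = ∀ ℓ s → Reach ℓ s → SatAll (I ℓ) s

  Reach-path : ∀ k (ls : Fin (suc k) → Fin (nL P)) (ss : Fin (suc k) → State nb nr) →
    Reach (ls zero) (ss zero) →
    (∀ (i : Fin k) → SatT (τ P (ls (inject₁ i)) (ls (suc i))) (ss (inject₁ i)) (ss (suc i))) →
    Reach (ls (fromℕ k)) (ss (fromℕ k))
  Reach-path ℕ.zero  ls ss r steps = r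
  Reach-path (suc k) ls ss r steps =
    Reach-path k (λ i → ls (suc i)) (λ i → ss (suc i))
               (reach-step r (steps zero)) (λ i → steps (suc i))

  IsCex⇒Reach-err : ∀ (c : Cex (nL P)) → IsCex P c → Reach (err P) (sts c (fromℕ (k c)))
  IsCex⇒Reach-err (cex k ls ss) c-cex =
    subst (λ ℓ → Reach ℓ (ss (fromℕ k))) (IsCex.ends c-cex)
      (Reach-path k ls ss at-start (IsCex.feasible c-cex))
    where
    at-start : Reach (ls zero) (ss zero)
    at-start = subst (λ ℓ → Reach ℓ (ss zero))
                  (sym (IsControlPath.starts (IsCex.path c-cex))) (reach-init (ss zero))

  SatAll-R₀ : ∀ (U : Prog nb nr) (σ : Fin (nL U) → Fin (nL P)) π {u ℓ s} →
    σ u ≡ ℓ → SatAll (π u) s → SatAll (R₀ P U σ π ℓ) s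
  SatAll-R₀ U σ π {u} {ℓ} {s} σu≡ℓ πu =
    SatAll-conjuncts (bigOr proofs) s
      (Sat-bigOr proofs s (map⁺ {f = λ v → bigAnd (π v)} (proofAt u∈us)))
    where
    us : List (Fin (nL U))
    us = filter (λ v → σ v ≟ᶠ ℓ) (allFin (nL U))
    proofs : List (Form nb nr)
    proofs = map (λ v → bigAnd (π v)) us
    u∈us : u ∈ us
    u∈us = ∈-filter⁺ (λ v → σ v ≟ᶠ ℓ) (∈-allFin u) σu≡ℓ
    proofAt : ∀ {vs} → u ∈ vs → Any (λ v → Sat (bigAnd (π v)) s) vs
    proofAt (here refl) = here (Sat-bigAnd (π u) s πu)
    proofAt (there u∈) = there (proofAt u∈)

  RemoveStep-⊆ : ∀ {I R R'} → RemoveStep P I R R' → ∀ ℓ → R' ℓ ⊆ R ℓ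
  RemoveStep-⊆ step ℓ with ℓ ≟ᶠ RemoveStep.ℓj step
  ... | no ℓ≢ℓj = λ x∈ → subst (_ ∈_) (RemoveStep.others step ℓ ℓ≢ℓj) x∈
  ... | yes refl = λ x∈ → subst (_ ∈_) (sym split) (drop (subst (_ ∈_) newj x∈))
    where
    open RemoveStep step
    drop : xs ++ ys ⊆ xs ++ φ ∷ ys
    drop x∈ with ∈-++⁻ xs x∈
    ... | inj₁ x∈xs = ∈-++⁺ˡ x∈xs
    ... | inj₂ x∈ys = ∈-++⁺ʳ xs (there x∈ys)

  RemoveLoop-⊆ : ∀ {I R R'} → Star (RemoveStep P I) R R' → ∀ ℓ → R' ℓ ⊆ R ℓ
  RemoveLoop-⊆ ε             ℓ = λ x∈ → x∈
  RemoveLoop-⊆ (step ◅ loop) ℓ = λ x∈ → RemoveStep-⊆ step ℓ (RemoveLoop-⊆ loop ℓ x∈)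

  ExtractInvs-invariant : ∀ {I U σ π I'} → IsInvariant I →
    σ (init U) ≡ init P → (∀ s → SatAll (π (init U)) s) →
    ExtractInvs P I U σ π I' → IsInvariant I'
  ExtractInvs-invariant {_} {U} {σ} {π} I-inv σ-init π-init ex ℓ s r =
    subst (λ Γ → SatAll Γ s) (sym (union ℓ)) (++⁺ (I-inv ℓ s r) (Rf-inv ℓ s r))
    where
    open ExtractInvs ex
    Rf-inv : IsInvariant Rf
    Rf-inv _ s (reach-init .s) =
      anti-mono (RemoveLoop-⊆ loop (init P)) (SatAll-R₀ U σ π σ-init (π-init s))
    Rf-inv ℓ s' (reach-step {i} {s = s} r t) =
      All.tabulate (λ {φ} φ∈ → stable i ℓ φ φ∈ s s' (Rf-inv i s r) (I-inv i s r) t)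

  record Consistent (S : AState P) : Set where
    field
      invariant : IsInvariant (I S)
      σ-init    : σ S (init (U S)) ≡ init P

  Reachable⇒Consistent : ∀ {S} → Reachable P S → Consistent S
  Reachable⇒Consistent (start ini) = record
    { invariant = λ ℓ s _ → subst (λ Γ → SatAll Γ s) (sym (Initial.noInvs ini ℓ)) []
    ; σ-init    = Refines.initσ (Initial.U⪯A ini)
    }
  Reachable⇒Consistent (next r (stepSafe π π-proof I' ex _ _ _ _ _ _ _ _ _ _ _ _ _ _ _ _ Û⪯A _ _)) =
    record
    { invariant = ExtractInvs-invariant invariant σ-init (SafetyProof.initTop π-proof) ex
    ; σ-init    = Refines.initσ Û⪯A
    }
    where open Consistent (Reachable⇒Consistent r)
  Reachable⇒Consistent (next r (stepRefine _ _ _ _ _ _ _)) =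
    record { invariant = invariant ; σ-init = σ-init }
    where open Consistent (Reachable⇒Consistent r)

theorem1 : ∀ {nb nr : ℕ} (P : Prog nb nr) → WF P →
           ∀ (S : AState P) → Reachable P S →
           (Returns P S SAFE → Safe P) × (Returns P S UNSAFE → ¬ Safe P)
theorem1 P _ S S-reach = safe , unsafe
  where
  open Consistent (Reachable⇒Consistent P S-reach)

  safe : Returns P S SAFE → Safe P
  safe (retSAFE π π-proof I' ex err-unsat) (c , c-cex) =
    err-unsat _ (I'-inv (err P) _ (IsCex⇒Reach-err P c c-cex))
    where
    I'-inv : IsInvariant P I'
    I'-inv = ExtractInvs-invariant P invariant σ-init (SafetyProof.initTop π-proof) ex

  unsafe : Returns P S UNSAFE → ¬ Safe P
  unsafe (retUNSAFE c _ σc-cex) P-safe = P-safe (mapCex (σ S) c , σc-cex)
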